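{- Let $(P,\leq)$ be a poset, let $f,g \in \operatorname{Aut}(P)$, let $A \subseteq P$ be $f$-invariant and $B \subseteq P$ be $g$-invariant, and let $h : A \to B$ be a function. Then the following are equivalent: (i) $h$ is an order embedding with $h \circ f = g \circ h$ on $A$; (ii) $h$ is an embedding of $L$-structures, where $A$ is regarded as a substructure of $P_f$ and $B$ as a substructure of $P_g$; (iii) $h$ is an embedding of $L'$-structures, where $L' = \{b_{ -1},b_0,b_1\}$ and $A$, $B$ are regarded as substructures of the $L'$-reducts of $P_f$, $P_g$. In particular, $f$ and $g$ are conjugate in $\operatorname{Aut}(P)$ if and only if $P_f \cong P_g$, if and only if the $L'$-reducts of $P_f$ and $P_g$ are isomorphic.
   Context: $L = \{b_i : i \in \mathbb{Z}\}$ is a language of binary relation symbols. For a poset $P$ and $f \in \operatorname{Aut}(P)$, $P_f$ is the $L$-structure with universe $P$ in which $b_i^f(x,y)$ holds iff $x \leq f^i(y)$. A set $A$ is $f$-invariant if $f[A] = A$. -}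

module Defs where

open import Level using (Level; _⊔_) renaming (suc to lsuc)
open import Data.Nat using (ℕ; zero; suc)
open import Data.Integer using (ℤ; +_; -[1+_]; -1ℤ; 0ℤ; 1ℤ)
open import Data.Product using (Σ; ∃; _×_; _,_)
open import Data.Sum using (_⊎_)
open import Data.Unit.Polymorphic using (⊤)
open import Data.Refinement using (Refinement; value)
open import Relation.Binary.Core using (Rel)
open import Relation.Binary.PropositionalEquality using (_≡_)
open import Function.Bundles using (_⇔_)
open import Function.Definitions using (Injective; Surjective)

-- The language L = {b_i : i ∈ ℤ}; a sublanguage is given by a predicate
-- on the indices.  L' = {b_{-1}, b_0, b_1}.

L : ℤ → Set
L _ = ⊤

L′ : ℤ → Set
L′ i = (i ≡ -1ℤ) ⊎ ((i ≡ 0ℤ) ⊎ (i ≡ 1ℤ))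

record Structure (c ℓ : Level) : Set (lsuc (c ⊔ ℓ)) where
  field
    Carrier : Set c
    rel     : ℤ → Rel Carrier ℓ
open Structure public

IsEmbedding : ∀ {c₁ c₂ ℓ} (S : ℤ → Set) (M : Structure c₁ ℓ) (N : Structure c₂ ℓ)
              → (Carrier M → Carrier N) → Set (c₁ ⊔ c₂ ⊔ ℓ)
IsEmbedding S M N h =
  Injective _≡_ _≡_ h ×
  (∀ i → S i → ∀ x y → rel M i x y ⇔ rel N i (h x) (h y))

Isomorphic : ∀ {c₁ c₂ ℓ} (S : ℤ → Set) (M : Structure c₁ ℓ) (N : Structure c₂ ℓ)
             → Set (c₁ ⊔ c₂ ⊔ ℓ)
Isomorphic S M N =
  Σ (Carrier M → Carrier N) λ h → IsEmbedding S M N h × Surjective _≡_ _≡_ h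

Sub : ∀ {c ℓ p} (M : Structure c ℓ) → (Carrier M → Set p) → Structure (c ⊔ p) ℓ
Sub M A = record
  { Carrier = Refinement (Carrier M) A
  ; rel     = λ i x y → rel M i (value x) (value y)
  }

iter : ∀ {c} {P : Set c} → (P → P) → ℕ → P → P
iter f zero    x = x
iter f (suc n) x = f (iter f n x)

module _ {c ℓ} {P : Set c} (_≤_ : Rel P ℓ) where

  record Aut : Set (c ⊔ ℓ) where
    field
      to       : P → P
      from     : P → P
      to∘from  : ∀ x → to (from x) ≡ x
      from∘to  : ∀ x → from (to x) ≡ x
      order    : ∀ x y → (x ≤ y) ⇔ (to x ≤ to y)
  open Aut public

  pow : Aut → ℤ → P → P
  pow f (+ n)      = iter (to f) n
  pow f -[1+ n ]   = iter (from f) (suc n)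

  Pf : Aut → Structure c ℓ
  Pf f = record { Carrier = P ; rel = λ i x y → x ≤ pow f i y }

  Invariant : ∀ {p} → Aut → (P → Set p) → Set (c ⊔ p)
  Invariant f A =
    (∀ x → A x → A (to f x)) ×
    (∀ y → A y → ∃ λ x → A x × to f x ≡ y)

  OrderEmbeddingCommuting : ∀ {p} (f g : Aut) (A B : P → Set p)
    → (Refinement P A → Refinement P B) → Set (c ⊔ ℓ ⊔ p)
  OrderEmbeddingCommuting f g A B h =
    (∀ a a′ → (value a ≤ value a′) ⇔ (value (h a) ≤ value (h a′))) ×
    (∀ a a′ → value a′ ≡ to f (value a) → value (h a′) ≡ to g (value (h a)))

  Conjugate : Aut → Aut → Set (c ⊔ ℓ)
  Conjugate f g = Σ Aut λ σ → ∀ x → to g x ≡ to σ (to f (from σ x))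

{-# OPTIONS --safe #-}
module Submission where

open import Defs
open import Level using (Level; _⊔_)
open import Data.Nat using (zero; suc)
open import Data.Integer using (ℤ; +_; -[1+_]; -1ℤ; 0ℤ; 1ℤ)
open import Data.Product using (_×_; ∃; _,_; proj₁; proj₂)
open import Data.Sum using (inj₁; inj₂)
open import Data.Unit.Polymorphic using (tt)
open import Data.Refinement using (Refinement; value; proof; value-injective)
import Data.Irrelevant as Irrelevant
open import Relation.Binary.Core using (Rel)
open import Relation.Binary.Structures using (IsPartialOrder)
open import Relation.Binary.PropositionalEquality using (_≡_; refl; sym; trans; cong)
open import Function.Base using (_∘_; id)
open import Function.Bundles using (_⇔_; mk⇔; Equivalence)
open import Function.Definitions using (Injective; Surjective)
open import Function.Properties.Equivalence using (⇔-setoid)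
import Relation.Binary.Reasoning.Setoid as ⇔-Reasoning

open Equivalence using () renaming (to to ⇒; from to ⇐)

-- For a, a′ in an f-invariant set, b₁(a′,a) ∧ b₋₁(a,a′) says a′ = f a, because
-- a ≤ f⁻¹ a′ ⇔ f a ≤ a′; so an embedding for b₋₁, b₀, b₁ is an order embedding
-- commuting with f and g. Conversely, such an h commutes with every fⁿ (n ≥ 0,
-- only f[A] ⊆ A is needed), and the adjunction a ≤ f⁻ⁿ a′ ⇔ fⁿ a ≤ a′ reduces
-- every bᵢ to b₀. For A = B = P, a surjective embedding is an automorphism
-- conjugating f to g.

tfae₃ : ∀ {a b c} {A : Set a} {B : Set b} {C : Set c} →
        (A → B) → (B → C) → (C → A) → (A ⇔ B) × (B ⇔ C)
tfae₃ a⇒b b⇒c c⇒a = mk⇔ a⇒b (c⇒a ∘ b⇒c) , mk⇔ b⇒c (a⇒b ∘ c⇒a)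

iter-suc : ∀ {a} {A : Set a} (t : A → A) n x → iter t (suc n) x ≡ iter t n (t x)
iter-suc t zero    x = refl
iter-suc t (suc n) x = cong t (iter-suc t n x)

IsEmbedding-restrict : ∀ {c₁ c₂ ℓ} {S S′ : ℤ → Set} {M : Structure c₁ ℓ} {N : Structure c₂ ℓ}
  {h : Carrier M → Carrier N} → (∀ i → S′ i → S i) → IsEmbedding S M N h → IsEmbedding S′ M N h
IsEmbedding-restrict S′⊆S (inj , rel⇔) = inj , λ i → rel⇔ i ∘ S′⊆S i

Isomorphic-restrict : ∀ {c₁ c₂ ℓ} {S S′ : ℤ → Set} {M : Structure c₁ ℓ} {N : Structure c₂ ℓ}
  → (∀ i → S′ i → S i) → Isomorphic S M N → Isomorphic S′ M N
Isomorphic-restrict {M = M} {N} S′⊆S (h , emb , surj) =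
  h , IsEmbedding-restrict {M = M} {N} S′⊆S emb , surj

L′⊆L : ∀ i → L′ i → L i
L′⊆L _ _ = tt

module Automorphism {c ℓ} {P : Set c} {_≤_ : Rel P ℓ} (f : Aut _≤_) where
  open ⇔-Reasoning (⇔-setoid ℓ)

  from-adjoint : ∀ x y → (x ≤ from f y) ⇔ (to f x ≤ y)
  from-adjoint x y = begin
    x ≤ from f y            ≈⟨ order f x (from f y) ⟩
    to f x ≤ to f (from f y) ≡⟨ cong (to f x ≤_) (to∘from f y) ⟩
    to f x ≤ y              ∎

  iter-from-adjoint : ∀ n x y → (x ≤ iter (from f) n y) ⇔ (iter (to f) n x ≤ y)
  iter-from-adjoint zero    x y = begin x ≤ y ∎
  iter-from-adjoint (suc n) x y = begin
    x ≤ from f (iter (from f) n y)   ≈⟨ from-adjoint x _ ⟩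
    to f x ≤ iter (from f) n y       ≈⟨ iter-from-adjoint n (to f x) y ⟩
    iter (to f) n (to f x) ≤ y       ≡⟨ cong (_≤ y) (sym (iter-suc (to f) n x)) ⟩
    iter (to f) (suc n) x ≤ y        ∎

open Automorphism

-- A substructure of P_f is handled through an arbitrary map ι : X → P
-- (value for a subset A, id for P itself); Induced f ι is definitionally
-- Sub (Pf _≤_ f) A resp. Pf _≤_ f.
module Embeddings {c ℓ x y} {P : Set c} {_≤_ : Rel P ℓ} (po : IsPartialOrder _≡_ _≤_)
  (f g : Aut _≤_) {X : Set x} {Y : Set y} (ι : X → P) (κ : Y → P) (h : X → Y) where
  open IsPartialOrder po using (antisym; reflexive)
  open ⇔-Reasoning (⇔-setoid ℓ)

  Induced : ∀ {z} {Z : Set z} → Aut _≤_ → (Z → P) → Structure z ℓ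
  Induced φ ρ = record { Carrier = _ ; rel = λ i a a′ → ρ a ≤ pow _≤_ φ i (ρ a′) }

  Preserves : ℤ → Set (x ⊔ ℓ)
  Preserves i = ∀ a a′ → rel (Induced f ι) i a a′ ⇔ rel (Induced g κ) i (h a) (h a′)

  Commutes : Set (x ⊔ c)
  Commutes = ∀ a a′ → ι a′ ≡ to f (ι a) → κ (h a′) ≡ to g (κ (h a))

  ForwardClosed : Set (x ⊔ c)
  ForwardClosed = ∀ a → ∃ λ a′ → ι a′ ≡ to f (ι a)

  b₋₁-b₁-preserved⇒commutes : Preserves -1ℤ → Preserves 1ℤ → Commutes
  b₋₁-b₁-preserved⇒commutes b₋₁ b₁ a a′ a′≡fa = antisym
    (⇒ (b₁ a′ a) (reflexive a′≡fa))
    (⇒ (from-adjoint g _ _) (⇒ (b₋₁ a a′) (⇐ (from-adjoint f _ _) (reflexive (sym a′≡fa)))))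

  commutes-iter : ForwardClosed → Commutes → ∀ n a →
    ∃ λ a′ → ι a′ ≡ iter (to f) n (ι a) × κ (h a′) ≡ iter (to g) n (κ (h a))
  commutes-iter closed comm zero    a = a , refl , refl
  commutes-iter closed comm (suc n) a with commutes-iter closed comm n a
  ... | aₙ , ιaₙ , κhaₙ with closed aₙ
  ...   | aₙ₊₁ , ιaₙ₊₁ = aₙ₊₁ , trans ιaₙ₊₁ (cong (to f) ιaₙ)
                              , trans (comm aₙ aₙ₊₁ ιaₙ₊₁) (cong (to g) κhaₙ)

  b₀-preserved⇒preserved : ForwardClosed → Commutes → Preserves 0ℤ → ∀ i → Preserves i
  b₀-preserved⇒preserved closed comm b₀ (+ n) a a′
    with b , ιb , κhb ← commutes-iter closed comm n a′ = begin
    ι a ≤ iter (to f) n (ι a′)          ≡⟨ cong (ι a ≤_) (sym ιb) ⟩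
    ι a ≤ ι b                           ≈⟨ b₀ a b ⟩
    κ (h a) ≤ κ (h b)                   ≡⟨ cong (κ (h a) ≤_) κhb ⟩
    κ (h a) ≤ iter (to g) n (κ (h a′))  ∎
  b₀-preserved⇒preserved closed comm b₀ -[1+ n ] a a′
    with b , ιb , κhb ← commutes-iter closed comm (suc n) a = begin
    ι a ≤ iter (from f) (suc n) (ι a′)          ≈⟨ iter-from-adjoint f (suc n) _ _ ⟩
    iter (to f) (suc n) (ι a) ≤ ι a′            ≡⟨ cong (_≤ ι a′) (sym ιb) ⟩
    ι b ≤ ι a′                                  ≈⟨ b₀ b a′ ⟩
    κ (h b) ≤ κ (h a′)                          ≡⟨ cong (_≤ κ (h a′)) κhb ⟩
    iter (to g) (suc n) (κ (h a)) ≤ κ (h a′)    ≈⟨ iter-from-adjoint g (suc n) _ _ ⟨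
    κ (h a) ≤ iter (from g) (suc n) (κ (h a′))  ∎

  b₀-preserved⇒injective : Injective _≡_ _≡_ ι → Preserves 0ℤ → Injective _≡_ _≡_ h
  b₀-preserved⇒injective ι-inj b₀ {a} {a′} ha≡ha′ = ι-inj (antisym
    (⇐ (b₀ a a′) (reflexive (cong κ ha≡ha′)))
    (⇐ (b₀ a′ a) (reflexive (cong κ (sym ha≡ha′)))))

  CommutingOrderEmbedding : Set (x ⊔ c ⊔ ℓ)
  CommutingOrderEmbedding = Preserves 0ℤ × Commutes

  commutingOrderEmbedding⇒embedding : Injective _≡_ _≡_ ι → ForwardClosed →
    CommutingOrderEmbedding → IsEmbedding L (Induced f ι) (Induced g κ) h
  commutingOrderEmbedding⇒embedding ι-inj closed (b₀ , comm) =
    b₀-preserved⇒injective ι-inj b₀ , λ i _ → b₀-preserved⇒preserved closed comm b₀ i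

  L′-embedding⇒commutingOrderEmbedding :
    IsEmbedding L′ (Induced f ι) (Induced g κ) h → CommutingOrderEmbedding
  L′-embedding⇒commutingOrderEmbedding (_ , rel⇔) =
    rel⇔ 0ℤ (inj₂ (inj₁ refl)) ,
    b₋₁-b₁-preserved⇒commutes (rel⇔ -1ℤ (inj₁ refl)) (rel⇔ 1ℤ (inj₂ (inj₂ refl)))

module _ {c ℓ} {P : Set c} {_≤_ : Rel P ℓ} (po : IsPartialOrder _≡_ _≤_) where

  subset-embeddings-tfae : ∀ {p} (f g : Aut _≤_) (A B : P → Set p) → Invariant _≤_ f A →
    (h : Refinement P A → Refinement P B) →
    (OrderEmbeddingCommuting _≤_ f g A B h ⇔ IsEmbedding L (Sub (Pf _≤_ f) A) (Sub (Pf _≤_ g) B) h)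
    × (IsEmbedding L (Sub (Pf _≤_ f) A) (Sub (Pf _≤_ g) B) h ⇔ IsEmbedding L′ (Sub (Pf _≤_ f) A) (Sub (Pf _≤_ g) B) h)
  subset-embeddings-tfae f g A B (f[A]⊆A , _) h = tfae₃
    (commutingOrderEmbedding⇒embedding value-injective closed)
    (IsEmbedding-restrict {M = Sub (Pf _≤_ f) A} {N = Sub (Pf _≤_ g) B} L′⊆L)
    L′-embedding⇒commutingOrderEmbedding
    where
    open Embeddings po f g value value h
    closed : ForwardClosed
    closed a = record { value = to f (value a) ; proof = Irrelevant.map (f[A]⊆A _) (proof a) } , refl

  conjugate⇒isomorphic : ∀ f g → Conjugate _≤_ f g → Isomorphic L (Pf _≤_ f) (Pf _≤_ g)
  conjugate⇒isomorphic f g (σ , g≡σfσ⁻¹) =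
    to σ , commutingOrderEmbedding⇒embedding id (λ a → to f a , refl) (order σ , σf≡gσ)
         , λ y → from σ y , λ { refl → to∘from σ y }
    where
    open Embeddings po f g id id (to σ)
    σf≡gσ : Commutes
    σf≡gσ a _ refl = sym (trans (g≡σfσ⁻¹ (to σ a)) (cong (to σ ∘ to f) (from∘to σ a)))

  orderIsomorphism⇒Aut : (h : P → P) → Injective _≡_ _≡_ h → Surjective _≡_ _≡_ h →
    (∀ x y → (x ≤ y) ⇔ (h x ≤ h y)) → Aut _≤_
  orderIsomorphism⇒Aut h inj surj order = record
    { to = h ; from = proj₁ ∘ surj ; to∘from = h∘h⁻¹ ; from∘to = λ x → inj (h∘h⁻¹ (h x))
    ; order = order }
    where
    h∘h⁻¹ : ∀ y → h (proj₁ (surj y)) ≡ y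
    h∘h⁻¹ y = proj₂ (surj y) refl

  L′-isomorphic⇒conjugate : ∀ f g → Isomorphic L′ (Pf _≤_ f) (Pf _≤_ g) → Conjugate _≤_ f g
  L′-isomorphic⇒conjugate f g (h , emb@(inj , _) , surj) =
    σ , λ x → trans (cong (to g) (sym (to∘from σ x))) (sym (hf≡gh (from σ x) _ refl))
    where
    open Embeddings po f g id id h
    b₀-and-hf≡gh : CommutingOrderEmbedding
    b₀-and-hf≡gh = L′-embedding⇒commutingOrderEmbedding emb
    hf≡gh : Commutes
    hf≡gh = proj₂ b₀-and-hf≡gh
    σ : Aut _≤_
    σ = orderIsomorphism⇒Aut h inj surj (proj₁ b₀-and-hf≡gh)

mainTheorem11 : ∀ {c ℓ p : Level} (P : Set c) (_≤_ : Rel P ℓ) → IsPartialOrder _≡_ _≤_ →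
    (∀ (f g : Aut _≤_) (A B : P → Set p) → Invariant _≤_ f A → Invariant _≤_ g B →
      (h : Refinement P A → Refinement P B) →
        (OrderEmbeddingCommuting _≤_ f g A B h ⇔ IsEmbedding L (Sub (Pf _≤_ f) A) (Sub (Pf _≤_ g) B) h)
        × (IsEmbedding L (Sub (Pf _≤_ f) A) (Sub (Pf _≤_ g) B) h ⇔ IsEmbedding L′ (Sub (Pf _≤_ f) A) (Sub (Pf _≤_ g) B) h))
    × (∀ (f g : Aut _≤_) →
        (Conjugate _≤_ f g ⇔ Isomorphic L (Pf _≤_ f) (Pf _≤_ g))
        × (Isomorphic L (Pf _≤_ f) (Pf _≤_ g) ⇔ Isomorphic L′ (Pf _≤_ f) (Pf _≤_ g)))
mainTheorem11 P _≤_ po =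
  (λ f g A B A-inv _ → subset-embeddings-tfae po f g A B A-inv) ,
  λ f g → tfae₃ (conjugate⇒isomorphic po f g)
                (Isomorphic-restrict {M = Pf _≤_ f} {N = Pf _≤_ g} L′⊆L)
                (L′-isomorphic⇒conjugate po f g)
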